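{- Let $G=(U,V,E)$ be a bipartite graph with $U \neq \emptyset$. Let $d_U=\max_{u\in U}|N(u)|$ and $d_V=\max_{v\in V}|N(v)|$ be the maximum degrees of vertices of $U$ and of $V$, and let $b_U$ be the bidegeneracy of $U$. Then $d_U \le b_U$ and $d_V \le b_U$.
   Context: A bipartite graph is $G=(U,V,E)$ with $U,V$ disjoint vertex sets and $E\subseteq U\times V$ (undirected). $N(x)$ denotes the set of neighbors of $x$ in $G$. For $u\in U$, $N_2(u)$ is the set of neighbors of neighbors of $u$, excluding $u$ itself (so $N_2(u)\subseteq U$), and the projection-extended neighborhood of $u$ is $N^{P}(u)=N(u)\cup N_2(u)$. The bidegeneracy $b(u)$ of a vertex $u\in U$ is the maximum value $b$ such that there exists $U'\subseteq U$ with $u\in U'$ satisfying $|N^{P}(x)\cap (U'\cup V)|\ge b$ for all $x\in U'$. The bidegeneracy of $U$ is $b_U=\max_{u\in U} b(u)$. -}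

module Defs where

open import Data.Nat using (ℕ; zero; suc; _+_; _≤_; _⊔_)
open import Data.Bool using (Bool; true; false; _∧_; if_then_else_)
open import Data.Fin using (Fin; zero; suc)
open import Data.Fin.Subset using (Subset; _∈_; inside)
open import Data.Vec.Functional using (foldr)
open import Data.Vec using (lookup)
open import Data.Product using (Σ; _×_; ∃)
open import Relation.Nullary using (¬_; does)
open import Relation.Nullary.Decidable using (⌊_⌋)
open import Data.Fin using (_≟_)
open import Data.Bool using (not)

-- A finite bipartite graph G = (U, V, E) with U = Fin m, V = Fin n,
-- and E ⊆ U × V given by its (decidable) indicator function.
record BipGraph (m n : ℕ) : Set where
  field
    E : Fin m → Fin n → Bool
open BipGraph public

count : ∀ {k} → (Fin k → Bool) → ℕ
count {k} p = foldr (λ b acc → (if b then 1 else 0) + acc) 0 p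

-- maximum of a Fin k-indexed family (0 for the empty family)
maxF : ∀ {k} → (Fin k → ℕ) → ℕ
maxF f = foldr _⊔_ 0 f

module _ {m n : ℕ} (G : BipGraph m n) where

  degU : Fin m → ℕ
  degU u = count (λ v → E G u v)

  degV : Fin n → ℕ
  degV v = count (λ u → E G u v)

  dU : ℕ
  dU = maxF degU

  dV : ℕ
  dV = maxF degV

  -- u' ∈ N₂(u): u' ≠ u and u, u' have a common neighbour in V
  inN₂ : Fin m → Fin m → Bool
  inN₂ u u' = not ⌊ u ≟ u' ⌋ ∧ foldr (λ v acc → (E G u v ∧ E G u' v) Data.Bool.∨ acc) false (λ v → v)

  -- |N^P(x) ∩ (U' ∪ V)| = |N(x)| + |N₂(x) ∩ U'|
  projDeg : Subset m → Fin m → ℕ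
  projDeg U' x = degU x + count (λ u' → inN₂ x u' ∧ lookup U' u')

  Witness : Fin m → ℕ → Subset m → Set
  Witness u b U' = u ∈ U' × (∀ x → x ∈ U' → b ≤ projDeg U' x)

  IsBidegeneracy : Fin m → ℕ → Set
  IsBidegeneracy u b = Σ (Subset m) (Witness u b) × (∀ b' U' → Witness u b' U' → b' ≤ b)

  IsBidegeneracyU : ℕ → Set
  IsBidegeneracyU b = (Σ (Fin m) λ u → IsBidegeneracy u b) × (∀ u b' → IsBidegeneracy u b' → b' ≤ b)

module Submission where

-- Any value b witnessed by some U' ∋ u satisfies b ≤ b(u) ≤ b_U: b(u) exists because
-- projected degrees are bounded by |U| + |V|, so the witnessed values have a greatest element. The singleton {u} witnesses |N(u)|, and for u ∈ N(v) the set N(v)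
-- witnesses |N(v)|: any x ∈ N(v) has at least one neighbour and has all of N(v) ∖ {x} in N₂(x).

open import Defs
open import Data.Nat using (ℕ; suc; _≤_)
open import Data.Product using (_×_)

open import Data.Nat using (zero; _+_; z≤n; s≤s; _≤?_)
open import Data.Nat.Properties
  using (≤-refl; ≤-trans; ≤-reflexive; m≤n+m; m≤m+n; +-mono-≤; +-monoˡ-≤; +-suc; ⊔-lub; m≤n⇒m<n∨m≡n)
open import Data.Bool using (Bool; true; false; _∧_; _∨_; if_then_else_)
open import Data.Bool.Properties using (∨-zeroʳ)
open import Data.Fin using (Fin; zero; suc; _≟_)
open import Data.Fin.Properties using (all?; suc-injective)
open import Data.Fin.Subset using (Subset; _∈_; ⁅_⁆)
open import Data.Fin.Subset.Properties using (_∈?_; x∈⁅x⁆; x∈⁅y⁆⇒x≡y; anySubset?)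
open import Data.Vec using (lookup; tabulate)
open import Data.Vec.Properties using ([]=⇒lookup; lookup⇒[]=; lookup∘tabulate)
open import Data.Vec.Functional using (foldr)
open import Data.Product using (∃; _,_)
open import Data.Sum using (_⊎_; inj₁; inj₂)
open import Data.Empty using (⊥-elim)
open import Function using (_∘_; id)
open import Relation.Nullary using (Dec; yes; no)
open import Relation.Nullary.Decidable using (_→-dec_; _×-dec_)
open import Relation.Unary using (Decidable)
open import Relation.Binary.PropositionalEquality using (_≡_; _≢_; refl; sym; trans; cong; subst)

bit : Bool → ℕ
bit b = if b then 1 else 0

bit≤1 : ∀ b → bit b ≤ 1
bit≤1 false = z≤n
bit≤1 true  = ≤-refl

bit-mono : ∀ {a b} → (a ≡ true → b ≡ true) → bit a ≤ bit b
bit-mono {false} _   = z≤n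
bit-mono {true}  a⇒b rewrite a⇒b refl = ≤-refl

count≤n : ∀ {k} (p : Fin k → Bool) → count p ≤ k
count≤n {zero}  p = z≤n
count≤n {suc k} p = +-mono-≤ (bit≤1 (p zero)) (count≤n (p ∘ suc))

count-pos : ∀ {k} (p : Fin k → Bool) {i} → p i ≡ true → 1 ≤ count p
count-pos p {zero}  pi rewrite pi = s≤s z≤n
count-pos p {suc i} pi = ≤-trans (count-pos (p ∘ suc) pi) (m≤n+m _ (bit (p zero)))

count≡0⊎∃true : ∀ {k} (p : Fin k → Bool) → count p ≡ 0 ⊎ ∃ λ i → p i ≡ true
count≡0⊎∃true {zero}  p = inj₁ refl
count≡0⊎∃true {suc k} p with p zero in p0
... | true  = inj₂ (zero , p0)
... | false with count≡0⊎∃true (p ∘ suc)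
...   | inj₁ count≡0     = inj₁ count≡0
...   | inj₂ (i , pi)    = inj₂ (suc i , pi)

count-mono : ∀ {k} (p q : Fin k → Bool) → (∀ i → p i ≡ true → q i ≡ true) → count p ≤ count q
count-mono {zero}  p q p⇒q = z≤n
count-mono {suc k} p q p⇒q = +-mono-≤ (bit-mono (p⇒q zero)) (count-mono (p ∘ suc) (q ∘ suc) (p⇒q ∘ suc))

count-mono-except : ∀ {k} (p q : Fin k → Bool) x →
  (∀ i → i ≢ x → p i ≡ true → q i ≡ true) → count p ≤ suc (count q)
count-mono-except {suc k} p q zero p⇒q =
  +-mono-≤ (bit≤1 (p zero))
    (≤-trans (count-mono (p ∘ suc) (q ∘ suc) (λ i → p⇒q (suc i) λ ())) (m≤n+m _ (bit (q zero))))
count-mono-except {suc k} p q (suc x) p⇒q = ≤-trans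
  (+-mono-≤ (bit-mono (p⇒q zero λ ()))
    (count-mono-except (p ∘ suc) (q ∘ suc) x λ i i≢x → p⇒q (suc i) (i≢x ∘ suc-injective)))
  (≤-reflexive (+-suc (bit (q zero)) _))

maxF-lub : ∀ {k} (f : Fin k → ℕ) {c} → (∀ i → f i ≤ c) → maxF f ≤ c
maxF-lub {zero}  f f≤c = z≤n
maxF-lub {suc k} f f≤c = ⊔-lub (f≤c zero) (maxF-lub (f ∘ suc) (f≤c ∘ suc))

any-true : ∀ {k} {A : Set} (h : A → Bool) (xs : Fin k → A) i → h (xs i) ≡ true →
  foldr (λ a acc → h a ∨ acc) false xs ≡ true
any-true h xs zero    hx rewrite hx = refl
any-true h xs (suc i) hx = trans (cong (h (xs zero) ∨_) (any-true h (xs ∘ suc) i hx)) (∨-zeroʳ _)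

module _ {P : ℕ → Set} (P? : Decidable P) where

  ∃-greatest : ∀ k → (∀ b → P b → b ≤ k) → ∀ {b₀} → P b₀ → ∃ λ b → P b × (∀ b' → P b' → b' ≤ b)
  ∃-greatest k ≤k pb₀ with P? k
  ... | yes pk = k , pk , ≤k
  ∃-greatest zero    ≤k pb₀ | no ¬pk with ≤k _ pb₀
  ... | z≤n = ⊥-elim (¬pk pb₀)
  ∃-greatest (suc k) ≤k pb₀ | no ¬pk = ∃-greatest k ≤k' pb₀
    where
    ≤k' : ∀ b → P b → b ≤ k
    ≤k' b pb with m≤n⇒m<n∨m≡n (≤k b pb)
    ... | inj₁ (s≤s b≤k) = b≤k
    ... | inj₂ refl      = ⊥-elim (¬pk pb)

module _ {m n : ℕ} (G : BipGraph m n) where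

  projDeg≤ : ∀ U' x → projDeg G U' x ≤ n + m
  projDeg≤ U' x = +-mono-≤ (count≤n (E G x)) (count≤n (λ u' → inN₂ G x u' ∧ lookup U' u'))

  witness? : ∀ u b U' → Dec (Witness G u b U')
  witness? u b U' = (u ∈? U') ×-dec all? (λ x → (x ∈? U') →-dec (b ≤? projDeg G U' x))

  witness⇒≤bidegeneracy : ∀ {u b U'} → Witness G u b U' → ∃ λ b' → b ≤ b' × IsBidegeneracy G u b'
  witness⇒≤bidegeneracy {u} w
    with ∃-greatest (λ b → anySubset? (witness? u b)) (n + m)
           (λ b (U' , u∈U' , bounded) → ≤-trans (bounded u u∈U') (projDeg≤ U' u)) (_ , w)
  ... | b' , attained , greatest = b' , greatest _ (_ , w) , attained , λ b U' w → greatest b (U' , w)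

  witness⇒≤bidegeneracyU : ∀ {bU u b U'} → IsBidegeneracyU G bU → Witness G u b U' → b ≤ bU
  witness⇒≤bidegeneracyU (_ , bU-max) w with witness⇒≤bidegeneracy w
  ... | b' , b≤b' , isBideg = ≤-trans b≤b' (bU-max _ b' isBideg)

  inN₂-intro : ∀ {x u v} → u ≢ x → E G x v ≡ true → E G u v ≡ true → inN₂ G x u ≡ true
  inN₂-intro {x} {u} {v} u≢x xv uv with x ≟ u
  ... | yes x≡u = ⊥-elim (u≢x (sym x≡u))
  ... | no _    = any-true (λ w → E G x w ∧ E G u w) id v (subst (λ b → b ∧ E G u v ≡ true) (sym xv) uv)

  singleton-witness : ∀ u → Witness G u (degU G u) ⁅ u ⁆
  singleton-witness u = x∈⁅x⁆ u , λ x x∈⁅u⁆ →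
    subst (λ y → degU G u ≤ projDeg G ⁅ u ⁆ y) (sym (x∈⁅y⁆⇒x≡y u x∈⁅u⁆)) (m≤m+n _ _)

  Nᵥ : Fin n → Subset m
  Nᵥ v = tabulate (λ u → E G u v)

  ∈Nᵥ⁺ : ∀ {u v} → E G u v ≡ true → u ∈ Nᵥ v
  ∈Nᵥ⁺ {u} {v} uv = lookup⇒[]= u (Nᵥ v) (trans (lookup∘tabulate _ u) uv)

  ∈Nᵥ⁻ : ∀ {u v} → u ∈ Nᵥ v → E G u v ≡ true
  ∈Nᵥ⁻ {u} u∈ = trans (sym (lookup∘tabulate _ u)) ([]=⇒lookup u∈)

  N₂-⊇-Nᵥ : ∀ {x v w} → x ∈ Nᵥ v → w ≢ x → E G w v ≡ true → inN₂ G x w ∧ lookup (Nᵥ v) w ≡ true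
  N₂-⊇-Nᵥ {x} {v} {w} x∈ w≢x wv
    rewrite inN₂-intro w≢x (∈Nᵥ⁻ x∈) wv | lookup∘tabulate (λ u → E G u v) w = wv

  neighbourhood-witness : ∀ {u v} → E G u v ≡ true → Witness G u (degV G v) (Nᵥ v)
  neighbourhood-witness {v = v} uv = ∈Nᵥ⁺ uv , λ x x∈ → ≤-trans
    (count-mono-except (λ w → E G w v) (λ w → inN₂ G x w ∧ lookup (Nᵥ v) w) x (λ w → N₂-⊇-Nᵥ x∈))
    (+-monoˡ-≤ _ (count-pos (E G x) (∈Nᵥ⁻ x∈)))

lemma1 : ∀ {m n : ℕ} (G : BipGraph (suc m) n) (bU : ℕ) → IsBidegeneracyU G bU → dU G ≤ bU × dV G ≤ bU
lemma1 G bU bideg =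
  maxF-lub (degU G) (witness⇒≤bidegeneracyU G bideg ∘ singleton-witness G) ,
  maxF-lub (degV G) degV≤bU
  where
  degV≤bU : ∀ v → degV G v ≤ bU
  degV≤bU v with count≡0⊎∃true (λ u → E G u v)
  ... | inj₁ degV≡0 rewrite degV≡0 = z≤n
  ... | inj₂ (u , uv)              = witness⇒≤bidegeneracyU G bideg (neighbourhood-witness G uv)
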